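{- For all positive integers $n$, $$|S_n(123,132,3214)|=|S_n(123,213,1432)|=|S_n(132,213,1234)|=t_n,$$ where $(t_n)$ is the Tribonacci sequence.
   Context: Permutations are written in one-line notation. For $\pi\in S_n$ and $\sigma\in S_k$, $\pi$ contains $\sigma$ if there are indices $1\le i_1<\dots<i_k\le n$ such that $(\pi_{i_1},\dots,\pi_{i_k})$ is order-isomorphic to $\sigma$ (i.e. $\pi_{i_a}<\pi_{i_b}$ iff $\sigma_a<\sigma_b$); otherwise $\pi$ avoids $\sigma$. $S_n(\sigma_1,\dots,\sigma_r)$ denotes the set of permutations in $S_n$ avoiding each of $\sigma_1,\dots,\sigma_r$. The Tribonacci numbers are indexed here by $t_1=1$, $t_2=2$, $t_3=4$ and $t_n=t_{n-1}+t_{n-2}+t_{n-3}$ for $n\ge4$. -}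

module Defs where

open import Data.Nat using (ℕ; zero; suc; _+_; _<_; _<?_)
open import Data.Fin using (Fin; toℕ)
open import Data.Fin.Properties using (_≟_)
open import Data.Vec using (Vec; []; _∷_; lookup)
open import Data.List using (List; []; _∷_; length; filter; map; concatMap; allFin)
open import Data.Product using (Σ; ∃; _×_; _,_)
open import Relation.Binary.PropositionalEquality using (_≡_; _≢_)
open import Relation.Nullary using (¬_; Dec)




-- Tribonacci numbers: t 1 = 1, t 2 = 2, t 3 = 4, t n = t (n-1) + t (n-2) + t (n-3).
-- (t 0 = 1 is an auxiliary value not used by the statement, consistent with t 3 = t 2 + t 1 + t 0.)
t : ℕ → ℕ
t zero = 1
t (suc zero) = 1
t (suc (suc zero)) = 2
t (suc (suc (suc n))) = t (suc (suc n)) + t (suc n) + t n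

-- A word of length k over values {0,…,n-1}, in one-line notation (position ↦ value).
Word : ℕ → ℕ → Set
Word n k = Vec (Fin n) k

allWords : (n k : ℕ) → List (Word n k)
allWords n zero = [] ∷ []
allWords n (suc k) = concatMap (λ x → map (x ∷_) (allWords n k)) (allFin n)

-- A word of length n over Fin n is a permutation of [n] iff its entries are distinct.
IsPerm : ∀ {n} → Word n n → Set
IsPerm {n} w = (i j : Fin n) → i ≢ j → lookup w i ≢ lookup w j

Contains : ∀ {n k} → Word n n → Word k k → Set
Contains {n} {k} π σ =
  Σ (Fin k → Fin n) λ ι →
    ((a b : Fin k) → toℕ a < toℕ b → toℕ (ι a) < toℕ (ι b)) ×
    ((a b : Fin k) → (toℕ (lookup π (ι a)) < toℕ (lookup π (ι b))
                      → toℕ (lookup σ a) < toℕ (lookup σ b)) ×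
                     (toℕ (lookup σ a) < toℕ (lookup σ b)
                      → toℕ (lookup π (ι a)) < toℕ (lookup π (ι b))))

Avoids : ∀ {n k} → Word n n → Word k k → Set
Avoids π σ = ¬ Contains π σ

open import Data.List.Membership.Propositional using (_∈_)
open import Data.List.Relation.Unary.Unique.Propositional using (Unique)
open import Data.List.Relation.Unary.All using (All)
open import Function.Bundles using (_⇔_)

data Pattern : Set where
  pat : (k : ℕ) → Word k k → Pattern

AvoidsAll : ∀ {n} → Word n n → List Pattern → Set
AvoidsAll π ps = All (λ { (pat k σ) → Avoids π σ }) ps

InS : (n : ℕ) → List Pattern → Word n n → Set
InS n ps w = IsPerm w × AvoidsAll w ps

HasCard : (n : ℕ) → List Pattern → ℕ → Set
HasCard n ps m =
  Σ (List (Word n n)) λ L →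
    Unique L × ((w : Word n n) → (w ∈ L ⇔ InS n ps w)) × (length L ≡ m)

-- Patterns, written 0-indexed (value i stands for i+1).
open import Data.Fin using (zero; suc)

p123 p132 p213 : Word 3 3
p123 = zero ∷ suc zero ∷ suc (suc zero) ∷ []
p132 = zero ∷ suc (suc zero) ∷ suc zero ∷ []
p213 = suc zero ∷ zero ∷ suc (suc zero) ∷ []

p3214 p1432 p1234 : Word 4 4
p3214 = suc (suc zero) ∷ suc zero ∷ zero ∷ suc (suc (suc zero)) ∷ []
p1432 = zero ∷ suc (suc (suc zero)) ∷ suc (suc zero) ∷ suc zero ∷ []
p1234 = zero ∷ suc zero ∷ suc (suc zero) ∷ suc (suc (suc zero)) ∷ []

-- Each of the three classes is closed under skew sums α ⊖ ρ (α placed above ρ): every basis pattern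
-- has its first entry below its last, so an occurrence cannot start in α and end in ρ.  Conversely, a
-- case analysis of the first entries shows that a member of size N begins with one of the blocks 1, 12
-- or τ (τ = 213, 132, 123 for the three classes) on the top values, followed by a member on the
-- remaining values.  So the members of size N are exactly 1 ⊖ ρ, 12 ⊖ ρ′ and τ ⊖ ρ″ with ρ, ρ′, ρ″ of
-- sizes N - 1, N - 2, N - 3, and their number satisfies the Tribonacci recurrence.
module Submission where

open import Defs
open import Data.Nat as ℕ using (ℕ; zero; suc; _+_; _∸_; _<_; _≤_; s≤s; z<s; s<s)
open import Data.Nat.Properties
open import Data.Fin as F using (Fin; zero; suc; toℕ; fromℕ<; inject≤)
import Data.Fin.Properties as FP
open import Data.Vec as V using (Vec; []; _∷_; lookup; tabulate)
import Data.Vec.Properties as VP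
open import Data.Vec.Relation.Unary.Linked using (Linked; []; [-]; _∷_)
import Data.Vec.Relation.Unary.Linked.Properties as Linked
open import Data.List as L using (List; []; _∷_; _++_; length)
open import Data.List.Properties using (∷-injectiveˡ; ∷-injectiveʳ; length-++; length-map; map-id; ++-cancelˡ)
open import Data.List.Membership.Propositional using (_∈_; _∉_)
open import Data.List.Membership.Propositional.Properties using (∈-map⁺; ∈-map⁻; ∈-++⁺ˡ; ∈-++⁺ʳ; ∈-++⁻)
open import Data.List.Relation.Unary.Any using (here; there)
open import Data.List.Relation.Unary.All as All using (All; []; _∷_)
open import Data.List.Relation.Unary.AllPairs using ([]; _∷_)
open import Data.List.Relation.Unary.Unique.Propositional using (Unique)
import Data.List.Relation.Unary.Unique.Propositional.Properties as Unique
open import Data.List.Relation.Unary.Unique.DecPropositional ℕ._≟_ using (unique?)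
open import Data.List.Relation.Binary.Disjoint.Propositional using (Disjoint)
open import Data.List.Relation.Binary.Equality.Propositional using (≋⇒≡)
open import Data.List.Relation.Binary.Sublist.Propositional
  using (_⊆_; []; _∷_; _∷ʳ_; minimum; from∈; ⊆-refl; ⊆-trans)
open import Data.List.Relation.Binary.Sublist.Propositional.Properties
  using (length-mono-≤; to-≋; ++⁺ˡ; All-resp-⊆)
open import Data.Product as Product using (Σ-syntax; ∃-syntax; _×_; _,_; proj₁; proj₂)
open import Data.Sum as Sum using (_⊎_; inj₁; inj₂)
open import Data.Empty using (⊥; ⊥-elim)
open import Data.Unit using (⊤; tt)
open import Function using (id; _∘_; case_of_; _⇔_; mk⇔; Equivalence)
open import Relation.Nullary using (¬_; Dec; yes; no)
open import Relation.Nullary.Decidable using (from-yes)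
open import Relation.Binary using (tri<; tri≈; tri>)
open import Relation.Binary.PropositionalEquality

values : ∀ {N k} → Vec (Fin N) k → List ℕ
values v = V.toList (V.map toℕ v)

length-values : ∀ {N k} (v : Vec (Fin N) k) → length (values v) ≡ k
length-values v = VP.length-toList (V.map toℕ v)

values-bounded : ∀ {N k} (v : Vec (Fin N) k) → All (_< N) (values v)
values-bounded []      = []
values-bounded (x ∷ v) = FP.toℕ<n x ∷ values-bounded v

values-injective : ∀ {N k} (u v : Vec (Fin N) k) → values u ≡ values v → u ≡ v
values-injective []      []      _  = refl
values-injective (x ∷ u) (y ∷ v) eq =
  cong₂ _∷_ (FP.toℕ-injective (∷-injectiveˡ eq)) (values-injective u v (∷-injectiveʳ eq))

values-++ : ∀ {N j k} (u : Vec (Fin N) j) (v : Vec (Fin N) k) → values (u V.++ v) ≡ values u ++ values v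
values-++ []      v = refl
values-++ (x ∷ u) v = cong (toℕ x ∷_) (values-++ u v)

values-map : ∀ {M N k} (f : Fin M → Fin N) (g : ℕ → ℕ) → (∀ a → toℕ (f a) ≡ g (toℕ a)) →
             (v : Vec (Fin M) k) → values (V.map f v) ≡ L.map g (values v)
values-map f g f≗g []      = refl
values-map f g f≗g (x ∷ v) = cong₂ _∷_ (f≗g x) (values-map f g f≗g v)

values-triple : ∀ {N} (v : Vec (Fin N) 3) →
  values v ≡ toℕ (lookup v zero) ∷ toℕ (lookup v (suc zero)) ∷ toℕ (lookup v (suc (suc zero))) ∷ []
values-triple (a ∷ b ∷ c ∷ []) = refl

lookup∈values : ∀ {N k} (v : Vec (Fin N) k) i → toℕ (lookup v i) ∈ values v
lookup∈values (x ∷ v) zero    = here refl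
lookup∈values (x ∷ v) (suc i) = there (lookup∈values v i)

∈values⇒lookup : ∀ {N k} (v : Vec (Fin N) k) {y} → y ∈ values v → ∃[ i ] toℕ (lookup v i) ≡ y
∈values⇒lookup (x ∷ v) (here y≡x)  = zero , sym y≡x
∈values⇒lookup (x ∷ v) (there y∈v) with i , vᵢ≡y ← ∈values⇒lookup v y∈v = suc i , vᵢ≡y

Distinct : ∀ {N k} → Vec (Fin N) k → Set
Distinct {k = k} v = (i j : Fin k) → i ≢ j → lookup v i ≢ lookup v j

distinct⇒unique : ∀ {N k} (v : Vec (Fin N) k) → Distinct v → Unique (values v)
distinct⇒unique []      _ = []
distinct⇒unique (x ∷ v) d =
  All.tabulate x∉v ∷ distinct⇒unique v (λ i j i≢j → d (suc i) (suc j) (i≢j ∘ FP.suc-injective))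
  where
  x∉v : ∀ {y} → y ∈ values v → toℕ x ≢ y
  x∉v y∈v x≡y with j , vⱼ≡y ← ∈values⇒lookup v y∈v =
    d zero (suc j) (λ ()) (FP.toℕ-injective (trans x≡y (sym vⱼ≡y)))

unique⇒distinct : ∀ {N k} (v : Vec (Fin N) k) → Unique (values v) → Distinct v
unique⇒distinct (x ∷ v) (x∉v ∷ v!) zero    zero    0≢0    = ⊥-elim (0≢0 refl)
unique⇒distinct (x ∷ v) (x∉v ∷ v!) zero    (suc j) _ x≡vⱼ = All.lookup x∉v (lookup∈values v j) (cong toℕ x≡vⱼ)
unique⇒distinct (x ∷ v) (x∉v ∷ v!) (suc i) zero    _ vᵢ≡x =
  All.lookup x∉v (lookup∈values v i) (cong toℕ (sym vᵢ≡x))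
unique⇒distinct (x ∷ v) (x∉v ∷ v!) (suc i) (suc j) i≢j    = unique⇒distinct v v! i j (i≢j ∘ cong suc)

Covers : ℕ → List ℕ → Set
Covers N xs = ∀ {y} → y < N → y ∈ xs

-- deleting a missed value y would make w an injection from Fin (suc N) into Fin N
isPerm⇒hits : ∀ {N} (w : Word (suc N) (suc N)) → IsPerm w → ∀ y → ¬ (∀ i → y ≢ lookup w i)
isPerm⇒hits w w-perm y y∉w with i , j , i<j , eq ← FP.pigeonhole (n<1+n _) (λ i → F.punchOut (y∉w i)) =
  w-perm i j (FP.<⇒≢ i<j) (FP.punchOut-injective (y∉w i) (y∉w j) eq)

isPerm⇒covers : ∀ {N} (w : Word N N) → IsPerm w → Covers N (values w)
isPerm⇒covers {suc N} w w-perm {y} y<N with FP.any? (λ i → lookup w i FP.≟ fromℕ< y<N)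
... | yes (i , wᵢ≡y) = subst (_∈ values w) (trans (cong toℕ wᵢ≡y) (FP.toℕ-fromℕ< y<N)) (lookup∈values w i)
... | no  y∉w        = ⊥-elim (isPerm⇒hits w w-perm (fromℕ< y<N) (λ i y≡wᵢ → y∉w (i , sym y≡wᵢ)))

n<2+n : ∀ n → n < 2 + n
n<2+n n = m<n⇒m<1+n (n<1+n n)

<-pred≢ : ∀ {x n} → x < suc n → x ≢ n → x < n
<-pred≢ x<1+n x≢n = ≤∧≢⇒< (ℕ.s≤s⁻¹ x<1+n) x≢n

∈-skip : ∀ xs {ys : List ℕ} {v} → v ∈ xs ++ ys → All (v ≢_) xs → v ∈ ys
∈-skip []       v∈ys       []          = v∈ys
∈-skip (x ∷ xs) (here v≡x) (v≢x ∷ _)   = ⊥-elim (v≢x v≡x)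
∈-skip (x ∷ xs) (there v∈) (_ ∷ v≢xs)  = ∈-skip xs v∈ v≢xs

later : ∀ {N} xs {r v} → Covers N (xs ++ r) → v < N → All (_< v) xs → v ∈ r
later xs cov v<N xs<v = ∈-skip xs (cov v<N) (All.map >⇒≢ xs<v)

in-some-order : ∀ {b c xs} → b ∈ xs → c ∈ xs → b ≢ c → b ∷ c ∷ [] ⊆ xs ⊎ c ∷ b ∷ [] ⊆ xs
in-some-order (here refl) c∈         b≢c = inj₁ (refl ∷ from∈ (∈-skip (_ ∷ []) c∈ ((b≢c ∘ sym) ∷ [])))
in-some-order (there b∈)  (here refl) _  = inj₂ (refl ∷ from∈ b∈)
in-some-order (there b∈)  (there c∈) b≢c = Sum.map (_ ∷ʳ_) (_ ∷ʳ_) (in-some-order b∈ c∈ b≢c)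

-- Pattern occurrences as sublists

StrictlyIncreasing : ∀ {k n} → (Fin k → Fin n) → Set
StrictlyIncreasing ι = ∀ a b → a F.< b → ι a F.< ι b

zero≢later : ∀ {k n} {ι : Fin (suc k) → Fin (suc n)} → StrictlyIncreasing ι → ∀ a → zero ≢ ι (suc a)
zero≢later {ι = ι} ι-inc a 0≡ι = n≮0 (subst (λ i → toℕ (ι zero) < toℕ i) (sym 0≡ι) (ι-inc zero (suc a) z<s))

increasing-∘suc : ∀ {k n} {ι : Fin (suc k) → Fin n} → StrictlyIncreasing ι → StrictlyIncreasing (ι ∘ suc)
increasing-∘suc ι-inc a b = ι-inc (suc a) (suc b) ∘ s<s

zero≢any : ∀ {k n} {ι : Fin (suc k) → Fin (suc n)} → StrictlyIncreasing ι → zero ≢ ι zero → ∀ a → zero ≢ ι a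
zero≢any ι-inc 0≢ι0 zero    = 0≢ι0
zero≢any ι-inc 0≢ι0 (suc a) = zero≢later ι-inc a

factor-suc : ∀ {k n} (ι : Fin k → Fin (suc n)) → (∀ a → zero ≢ ι a) → StrictlyIncreasing ι →
             Σ[ ι′ ∈ (Fin k → Fin n) ] StrictlyIncreasing ι′ × (∀ a → suc (ι′ a) ≡ ι a)
factor-suc ι ι≢0 ι-inc = ι′ , ι′-inc , suc∘ι′≡ι
  where
  ι′ = λ a → F.punchOut (ι≢0 a)
  suc∘ι′≡ι = λ a → FP.punchIn-punchOut (ι≢0 a)
  ι′-inc : StrictlyIncreasing ι′
  ι′-inc a b a<b = ℕ.s<s⁻¹ (subst₂ F._<_ (sym (suc∘ι′≡ι a)) (sym (suc∘ι′≡ι b)) (ι-inc a b a<b))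

module _ {A : Set} where

  ⊆⇒embedding : ∀ {k n} (w : Vec A k) (u : Vec A n) → V.toList w ⊆ V.toList u →
    Σ[ ι ∈ (Fin k → Fin n) ] StrictlyIncreasing ι × (∀ a → lookup u (ι a) ≡ lookup w a)
  ⊆⇒embedding []      u        _            = (λ ()) , (λ ()) , (λ ())
  ⊆⇒embedding (x ∷ w) (y ∷ u)  (.y ∷ʳ w⊆u) with ι , ι-inc , ι-eq ← ⊆⇒embedding (x ∷ w) u w⊆u =
    suc ∘ ι , (λ a b → s<s ∘ ι-inc a b) , ι-eq
  ⊆⇒embedding (x ∷ w) (.x ∷ u) (refl ∷ w⊆u) with ι , ι-inc , ι-eq ← ⊆⇒embedding w u w⊆u = ι′ , ι′-inc , ι′-eq
    where
    ι′ : Fin _ → Fin _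
    ι′ zero    = zero
    ι′ (suc a) = suc (ι a)
    ι′-inc : StrictlyIncreasing ι′
    ι′-inc zero    (suc b) _         = z<s
    ι′-inc (suc a) (suc b) (s<s a<b) = s<s (ι-inc a b a<b)
    ι′-eq : ∀ a → lookup (x ∷ u) (ι′ a) ≡ lookup (x ∷ w) a
    ι′-eq zero    = refl
    ι′-eq (suc a) = ι-eq a

  embedding⇒⊆ : ∀ {k n} (w : Vec A k) (u : Vec A n) (ι : Fin k → Fin n) → StrictlyIncreasing ι →
                (∀ a → lookup u (ι a) ≡ lookup w a) → V.toList w ⊆ V.toList u
  embedding⇒⊆ []      u       ι _     _    = minimum _
  embedding⇒⊆ (x ∷ w) []      ι _     _    with () ← ι zero
  embedding⇒⊆ (x ∷ w) (y ∷ u) ι ι-inc ι-eq with ι zero in ι0≡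
  ... | zero with ι′ , ι′-inc , suc∘ι′≡ι ← factor-suc (ι ∘ suc) (zero≢later ι-inc) (increasing-∘suc ι-inc) =
    trans (sym (ι-eq zero)) (cong (lookup (y ∷ u)) ι0≡) ∷
    embedding⇒⊆ w u ι′ ι′-inc (λ a → trans (cong (lookup (y ∷ u)) (suc∘ι′≡ι a)) (ι-eq (suc a)))
  ... | suc _
    with ι′ , ι′-inc , suc∘ι′≡ι ← factor-suc ι (zero≢any ι-inc (λ 0≡ι0 → case trans 0≡ι0 ι0≡ of λ ())) ι-inc =
    y ∷ʳ embedding⇒⊆ (x ∷ w) u ι′ ι′-inc (λ a → trans (cong (lookup (y ∷ u)) (suc∘ι′≡ι a)) (ι-eq a))

Occurs : (List ℕ → Set) → List ℕ → Set
Occurs P xs = ∃[ ys ] ys ⊆ xs × P ys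

occurs-⊆ : ∀ {P xs ys} → xs ⊆ ys → Occurs P xs → Occurs P ys
occurs-⊆ xs⊆ys (zs , zs⊆xs , pz) = zs , ⊆-trans zs⊆xs xs⊆ys , pz

size : Pattern → ℕ
size (pat k _) = k

-- ys is order-isomorphic to σ: it lists the entries of some increasing vector s in the order σ prescribes
Shaped : Pattern → List ℕ → Set
Shaped (pat k σ) ys = Σ[ s ∈ Vec ℕ k ] Linked _<_ s × ys ≡ V.toList (V.map (lookup s) σ)

Involutive : Pattern → Set
Involutive (pat k σ) = ∀ a → lookup σ (lookup σ a) ≡ a

linked-tabulate : ∀ {k} {f : Fin k → ℕ} → (∀ i j → i F.< j → f i < f j) → Linked _<_ (tabulate f)
linked-tabulate {zero}        f-inc = []
linked-tabulate {suc zero}    f-inc = [-]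
linked-tabulate {suc (suc k)} f-inc = f-inc zero (suc zero) z<s ∷ linked-tabulate (λ i j → f-inc (suc i) (suc j) ∘ s<s)

linked-lookup⁻ : ∀ {k} {s : Vec ℕ k} → Linked _<_ s → ∀ {i j} → lookup s i < lookup s j → i F.< j
linked-lookup⁻ s↑ {i} {j} sᵢ<sⱼ with FP.<-cmp i j
... | tri< i<j _ _  = i<j
... | tri≈ _ refl _ = ⊥-elim (<-irrefl refl sᵢ<sⱼ)
... | tri> _ _ j<i  = ⊥-elim (<-asym sᵢ<sⱼ (Linked.lookup⁺ <-trans s↑ j<i))

-- since σ is its own inverse, the increasing rearrangement of an occurrence ys is ys ∘ σ
contains⇔occurs : ∀ {k n} (σ : Word k k) → Involutive (pat k σ) → (π : Word n n) →
                  Contains π σ ⇔ Occurs (Shaped (pat k σ)) (values π)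
contains⇔occurs {k} σ σ∘σ≡id π = mk⇔ to from
  where
  open ≡-Reasoning
  to : Contains π σ → Occurs (Shaped (pat k σ)) (values π)
  to (ι , ι-inc , ι-iso) =
    V.toList w , embedding⇒⊆ w (V.map toℕ π) ι ι-inc πι≡wₐ , s , linked-tabulate s-inc , cong V.toList w≡
    where
    f : Fin k → ℕ
    f a = toℕ (lookup π (ι a))
    w = tabulate f
    s = tabulate (f ∘ lookup σ)
    πι≡wₐ : ∀ a → lookup (V.map toℕ π) (ι a) ≡ lookup w a
    πι≡wₐ a = trans (VP.lookup-map (ι a) toℕ π) (sym (VP.lookup∘tabulate f a))
    s-inc : ∀ i j → i F.< j → f (lookup σ i) < f (lookup σ j)
    s-inc i j i<j = proj₂ (ι-iso (lookup σ i) (lookup σ j)) (subst₂ F._<_ (sym (σ∘σ≡id i)) (sym (σ∘σ≡id j)) i<j)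
    w≡ : w ≡ V.map (lookup s) σ
    w≡ = trans (VP.tabulate-cong λ a → sym (begin
      lookup (V.map (lookup s) σ) a  ≡⟨ VP.lookup-map a (lookup s) σ ⟩
      lookup s (lookup σ a)          ≡⟨ VP.lookup∘tabulate (f ∘ lookup σ) (lookup σ a) ⟩
      f (lookup σ (lookup σ a))      ≡⟨ cong f (σ∘σ≡id a) ⟩
      f a                            ∎)) (VP.tabulate∘lookup (V.map (lookup s) σ))
  from : Occurs (Shaped (pat k σ)) (values π) → Contains π σ
  from (_ , ys⊆ , s , s↑ , refl) with ι , ι-inc , ι-eq ← ⊆⇒embedding (V.map (lookup s) σ) (V.map toℕ π) ys⊆ =
    ι , ι-inc , λ a b → (linked-lookup⁻ s↑ ∘ subst₂ _<_ (πι≡ a) (πι≡ b)) ,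
                        (subst₂ _<_ (sym (πι≡ a)) (sym (πι≡ b)) ∘ Linked.lookup⁺ <-trans s↑)
    where
    πι≡ : ∀ a → toℕ (lookup π (ι a)) ≡ lookup s (lookup σ a)
    πι≡ a = trans (sym (VP.lookup-map (ι a) toℕ π)) (trans (ι-eq a) (VP.lookup-map a (lookup s) σ))

Avoiding : List Pattern → List ℕ → Set
Avoiding ps xs = All (λ p → ¬ Occurs (Shaped p) xs) ps

Av : List Pattern → List ℕ → Set
Av ps xs = Unique xs × Avoiding ps xs

avoidsAll⇔avoiding : ∀ {n ps} → All Involutive ps → (π : Word n n) → AvoidsAll π ps ⇔ Avoiding ps (values π)
avoidsAll⇔avoiding []                                   π = mk⇔ (λ _ → []) (λ _ → [])
avoidsAll⇔avoiding {ps = pat k σ ∷ ps} (σ-inv ∷ ps-inv) π = mk⇔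
  (λ { (¬c ∷ ¬cs) → ¬c ∘ Equivalence.from σ-bridge ∷ Equivalence.to   rest ¬cs })
  (λ { (¬o ∷ ¬os) → ¬o ∘ Equivalence.to   σ-bridge ∷ Equivalence.from rest ¬os })
  where
  σ-bridge = contains⇔occurs σ σ-inv π
  rest     = avoidsAll⇔avoiding ps-inv π

inS⇔av : ∀ {n ps} → All Involutive ps → (π : Word n n) → InS n ps π ⇔ Av ps (values π)
inS⇔av ps-inv π = mk⇔
  (Product.map (distinct⇒unique π) (Equivalence.to   (avoidsAll⇔avoiding ps-inv π)))
  (Product.map (unique⇒distinct π) (Equivalence.from (avoidsAll⇔avoiding ps-inv π)))

avoiding-⊆ : ∀ {ps xs ys} → xs ⊆ ys → Avoiding ps ys → Avoiding ps xs
avoiding-⊆ xs⊆ys = All.map (_∘ occurs-⊆ xs⊆ys)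

shaped-length : ∀ p {ys} → Shaped p ys → length ys ≡ size p
shaped-length (pat k σ) (s , _ , refl) = VP.length-toList (V.map (lookup s) σ)

occurs⇒≤length : ∀ p {xs} → Occurs (Shaped p) xs → size p ≤ length xs
occurs⇒≤length p (ys , ys⊆xs , shaped) = subst (_≤ _) (shaped-length p shaped) (length-mono-≤ ys⊆xs)

¬occurs-longer : ∀ p {xs} → length xs < size p → ¬ Occurs (Shaped p) xs
¬occurs-longer p xs<p occ = <⇒≱ xs<p (occurs⇒≤length p occ)

avoiding-short : ∀ {ps xs} → All (λ p → length xs < size p) ps → Avoiding ps xs
avoiding-short = All.map λ {p} → ¬occurs-longer p

¬shaped⇒¬occurs : ∀ p {xs} → length xs ≤ size p → ¬ Shaped p xs → ¬ Occurs (Shaped p) xs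
¬shaped⇒¬occurs p xs≤p ¬shaped (ys , ys⊆xs , shaped) = ¬shaped (subst (Shaped p) ys≡xs shaped)
  where
  xs≤ys = ≤-trans xs≤p (≤-reflexive (sym (shaped-length p shaped)))
  ys≡xs = ≋⇒≡ (to-≋ (≤-antisym (length-mono-≤ ys⊆xs) xs≤ys) ys⊆xs)

-- Skew sums

LastAbove : ℕ → List ℕ → Set
LastAbove m []           = ⊤
LastAbove m (y ∷ [])     = m < y
LastAbove m (_ ∷ y ∷ ys) = LastAbove m (y ∷ ys)

FirstBelowLast : (List ℕ → Set) → Set
FirstBelowLast P = ∀ {x ys} → P (x ∷ ys) → LastAbove x ys

lastAbove-tail : ∀ {m y} ys → LastAbove m (y ∷ ys) → LastAbove m ys
lastAbove-tail []      _ = tt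
lastAbove-tail (_ ∷ _) h = h

lastAbove-≤ : ∀ {m x} ys → m ≤ x → LastAbove x ys → LastAbove m ys
lastAbove-≤ []           _   _   = tt
lastAbove-≤ (y ∷ [])     m≤x x<y = ≤-<-trans m≤x x<y
lastAbove-≤ (_ ∷ y ∷ ys) m≤x h   = lastAbove-≤ (y ∷ ys) m≤x h

lastAbove-below : ∀ {m} ys → All (_< m) ys → LastAbove m ys → ys ≡ []
lastAbove-below []           _          _   = refl
lastAbove-below (y ∷ [])     (y<m ∷ []) m<y = ⊥-elim (<-asym y<m m<y)
lastAbove-below (_ ∷ y ∷ ys) (_ ∷ y<m)  h   with () ← lastAbove-below (y ∷ ys) y<m h

⊆-++-lastAbove : ∀ {m} xs {ys zs} → All (_< m) ys → LastAbove m zs → zs ⊆ xs ++ ys → zs ⊆ xs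
⊆-++-lastAbove []       {zs = zs}     ys<m h zs⊆ys with refl ← lastAbove-below zs (All-resp-⊆ zs⊆ys ys<m) h = []
⊆-++-lastAbove (x ∷ xs)               ys<m h (.x ∷ʳ zs⊆) = x ∷ʳ ⊆-++-lastAbove xs ys<m h zs⊆
⊆-++-lastAbove (x ∷ xs) {zs = _ ∷ zs} ys<m h (refl ∷ zs⊆) =
  refl ∷ ⊆-++-lastAbove xs ys<m (lastAbove-tail zs h) zs⊆

-- an occurrence starting in xs and reaching into ys would end below its first entry
occurs-skewSum : ∀ {P m} → FirstBelowLast P → ∀ xs {ys} → All (m ≤_) xs → All (_< m) ys →
                 Occurs P (xs ++ ys) → Occurs P xs ⊎ Occurs P ys
occurs-skewSum first<last []       _          _    occ = inj₂ occ
occurs-skewSum first<last (x ∷ xs) (_ ∷ xs≥m) ys<m (zs , .x ∷ʳ zs⊆ , pz) =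
  Sum.map₁ (occurs-⊆ (x ∷ʳ ⊆-refl)) (occurs-skewSum first<last xs xs≥m ys<m (zs , zs⊆ , pz))
occurs-skewSum first<last (x ∷ xs) (m≤x ∷ _) ys<m (.x ∷ zs , refl ∷ zs⊆ , pz) =
  inj₁ (x ∷ zs , refl ∷ ⊆-++-lastAbove xs ys<m (lastAbove-≤ zs m≤x (first<last pz)) zs⊆ , pz)

avoiding-skewSum : ∀ {ps m xs ys} → All (FirstBelowLast ∘ Shaped) ps → All (m ≤_) xs → All (_< m) ys →
                   Avoiding ps xs → Avoiding ps ys → Avoiding ps (xs ++ ys)
avoiding-skewSum []                         _    _    []           []             = []
avoiding-skewSum {xs = xs} (fbl ∷ fbls) xs≥m ys<m (¬occ ∷ ¬occs) (¬occ′ ∷ ¬occs′) =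
  Sum.[ ¬occ , ¬occ′ ] ∘ occurs-skewSum fbl xs xs≥m ys<m ∷ avoiding-skewSum fbls xs≥m ys<m ¬occs ¬occs′

av-skewSum : ∀ {ps m xs ys} → All (FirstBelowLast ∘ Shaped) ps → All (m ≤_) xs → All (_< m) ys →
             Av ps xs → Av ps ys → Av ps (xs ++ ys)
av-skewSum fbls xs≥m ys<m (xs! , xs-av) (ys! , ys-av) =
  Unique.++⁺ xs! ys! (λ (v∈xs , v∈ys) → <⇒≱ (All.lookup ys<m v∈ys) (All.lookup xs≥m v∈xs)) ,
  avoiding-skewSum fbls xs≥m ys<m xs-av ys-av

unique-++ʳ : ∀ xs {ys : List ℕ} → Unique (xs ++ ys) → Unique ys
unique-++ʳ []       ys!           = ys!
unique-++ʳ (x ∷ xs) (_ ∷ xs++ys!) = unique-++ʳ xs xs++ys!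

av-++ʳ : ∀ {ps} xs {ys} → Av ps (xs ++ ys) → Av ps ys
av-++ʳ xs (xs++ys! , av) = unique-++ʳ xs xs++ys! , avoiding-⊆ (++⁺ˡ xs ⊆-refl) av

unique-++-disjoint : ∀ xs {ys : List ℕ} {y} → Unique (xs ++ ys) → y ∈ ys → y ∉ xs
unique-++-disjoint (x ∷ xs) (x∉ ∷ _) y∈ys (here refl)  = All.lookup x∉ (∈-++⁺ʳ xs y∈ys) refl
unique-++-disjoint (x ∷ xs) (_ ∷ u)  y∈ys (there y∈xs) = unique-++-disjoint xs u y∈ys y∈xs

shift : ℕ → List ℕ → List ℕ
shift n = L.map (_+ n)

shift-≥ : ∀ n xs → All (n ≤_) (shift n xs)
shift-≥ n []       = []
shift-≥ n (x ∷ xs) = m≤n+m n x ∷ shift-≥ n xs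

-- shift n xs already takes every value in [n, j + n)
below-block : ∀ {j n xs ys} → Covers j xs → Unique (shift n xs ++ ys) → All (_< j + n) ys → All (_< n) ys
below-block {j} {n} {xs} {ys} xs-covers xs++ys! ys< = All.tabulate below
  where
  below : ∀ {y} → y ∈ ys → y < n
  below {y} y∈ys with y <? n
  ... | yes y<n = y<n
  ... | no  y≮n = ⊥-elim (unique-++-disjoint (shift n xs) xs++ys! y∈ys y∈block)
    where
    n≤y     = ≮⇒≥ y≮n
    y∸n<j   = subst (y ∸ n <_) (m+n∸n≡m j n) (∸-monoˡ-< (All.lookup ys< y∈ys) n≤y)
    y∈block = subst (_∈ shift n xs) (m∸n+n≡m n≤y) (∈-map⁺ (_+ n) (xs-covers y∸n<j))

raise : ∀ {j} n → Fin j → Fin (j + n)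
raise n a = fromℕ< (+-monoˡ-< n (FP.toℕ<n a))

embed : ∀ {n} j → Fin n → Fin (j + n)
embed j r = inject≤ r (m≤n+m _ j)

-- α on the top j values, followed by ρ on the bottom n values
infixr 5 _⊖_
_⊖_ : ∀ {j n} → Word j j → Word n n → Word (j + n) (j + n)
_⊖_ {j} {n} α ρ = V.map (raise n) α V.++ V.map (embed j) ρ

values-raise : ∀ {j k} n (α : Vec (Fin j) k) → values (V.map (raise n) α) ≡ shift n (values α)
values-raise n = values-map (raise n) (_+ n) (λ a → FP.toℕ-fromℕ< _)

values-embed : ∀ {n k} j (ρ : Vec (Fin n) k) → values (V.map (embed j) ρ) ≡ values ρ
values-embed j ρ = trans (values-map (embed j) id (λ r → FP.toℕ-inject≤ r _) ρ) (map-id (values ρ))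

values-⊖ : ∀ {j n} (α : Word j j) (ρ : Word n n) → values (α ⊖ ρ) ≡ shift n (values α) ++ values ρ
values-⊖ {j} {n} α ρ = begin
  values (V.map (raise n) α V.++ V.map (embed j) ρ)
    ≡⟨ values-++ (V.map (raise n) α) _ ⟩
  values (V.map (raise n) α) ++ values (V.map (embed j) ρ)
    ≡⟨ cong₂ _++_ (values-raise n α) (values-embed j ρ) ⟩
  shift n (values α) ++ values ρ
    ∎
  where open ≡-Reasoning

⊖-injectiveʳ : ∀ {j n} (α : Word j j) {ρ ρ′ : Word n n} → α ⊖ ρ ≡ α ⊖ ρ′ → ρ ≡ ρ′
⊖-injectiveʳ {n = n} α {ρ} {ρ′} eq = values-injective ρ ρ′
  (++-cancelˡ (shift n (values α)) _ _ (trans (sym (values-⊖ α ρ)) (trans (cong values eq) (values-⊖ α ρ′))))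

lower : ∀ {M n k} (v : Vec (Fin M) k) → All (_< n) (values v) → Vec (Fin n) k
lower []      []          = []
lower (x ∷ v) (x<n ∷ v<n) = fromℕ< x<n ∷ lower v v<n

values-lower : ∀ {M n k} (v : Vec (Fin M) k) (v<n : All (_< n) (values v)) → values (lower v v<n) ≡ values v
values-lower []      []          = refl
values-lower (x ∷ v) (x<n ∷ v<n) = cong₂ _∷_ (FP.toℕ-fromℕ< x<n) (values-lower v v<n)

++-cancel-length : ∀ (xs ys : List ℕ) {zs ws} → length xs ≡ length ys → xs ++ zs ≡ ys ++ ws → xs ≡ ys × zs ≡ ws
++-cancel-length []       []       _         eq = refl , eq
++-cancel-length (x ∷ xs) (y ∷ ys) ∣xs∣≡∣ys∣ eq with refl ← ∷-injectiveˡ eq =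
  Product.map₁ (cong (x ∷_)) (++-cancel-length xs ys (suc-injective ∣xs∣≡∣ys∣) (∷-injectiveʳ eq))

peel : ∀ {ps j n xs} (α : Word j j) → Unique (values α) → (w : Word (j + n) (j + n)) → Av ps (values w) →
       values w ≡ shift n (values α) ++ xs → Σ[ ρ ∈ Word n n ] w ≡ α ⊖ ρ × Av ps (values ρ)
peel {ps} {j} {n} α α! w w-av eq with u , v , refl ← V.splitAt j w =
  lower v v<n , cong₂ V._++_ u≡ v≡ , subst (Av ps) (sym (values-lower v v<n)) (av-++ʳ (values u) uv-av)
  where
  uv-av : Av ps (values u ++ values v)
  uv-av = subst (Av ps) (values-++ u v) w-av
  u-values : values u ≡ shift n (values α)
  u-values = proj₁ (++-cancel-length (values u) (shift n (values α))
               (trans (length-values u) (sym (trans (length-map (_+ n) (values α)) (length-values α))))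
               (trans (sym (values-++ u v)) eq))
  v<n : All (_< n) (values v)
  v<n = below-block (isPerm⇒covers α (unique⇒distinct α α!))
          (subst (λ zs → Unique (zs ++ _)) u-values (proj₁ uv-av)) (values-bounded v)
  u≡ : u ≡ V.map (raise n) α
  u≡ = values-injective _ _ (trans u-values (sym (values-raise n α)))
  v≡ : v ≡ V.map (embed j) (lower v v<n)
  v≡ = values-injective _ _ (sym (trans (values-embed j _) (values-lower v v<n)))

map-disjoint : ∀ {A B C : Set} {f : A → C} {g : B → C} {as bs} → (∀ {a b} → f a ≢ g b) →
               Disjoint (L.map f as) (L.map g bs)
map-disjoint f≢g (c∈fas , c∈gbs) with ∈-map⁻ _ c∈fas | ∈-map⁻ _ c∈gbs
... | a , _ , refl | b , _ , fa≡gb = f≢g fa≡gb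

-- xs, the values of a permutation of size N, begins with 1, 12 or τ placed above the remaining values
data TopBlock (τ : Word 3 3) : ℕ → List ℕ → Set where
  one   : ∀ {n} xs → TopBlock τ (1 + n) (n ∷ xs)
  two   : ∀ {n} xs → TopBlock τ (2 + n) (n ∷ suc n ∷ xs)
  three : ∀ {n} xs → TopBlock τ (3 + n) (shift n (values τ) ++ xs)

module TribonacciClass
  (ps                : List Pattern)
  (ps-involutive     : All Involutive ps)
  (ps-long           : All (λ p → 2 < size p) ps)
  (ps-firstBelowLast : All (FirstBelowLast ∘ Shaped) ps)
  (τ                 : Word 3 3)
  (τ!                : Unique (values τ))
  (τ-avoiding        : ∀ n → Avoiding ps (shift n (values τ)))
  -- keep τ ⊖ ρ apart from every 1 ⊖ ρ′ and 12 ⊖ ρ′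
  (τ₀≢2              : toℕ (lookup τ zero) ≢ 2)
  (τ₀τ₁≢12           : ¬ (toℕ (lookup τ zero) ≡ 1 × toℕ (lookup τ (suc zero)) ≡ 2))
  (topBlock          : ∀ {N xs} → Av ps xs → All (_< suc N) xs → Covers (suc N) xs → TopBlock τ (suc N) xs)
  where

  p1 : Word 1 1
  p1 = zero ∷ []

  p12 : Word 2 2
  p12 = zero ∷ suc zero ∷ []

  members : (N : ℕ) → List (Word N N)
  members 0 = [] ∷ []
  members 1 = L.map (p1 ⊖_) (members 0)
  members 2 = L.map (p1 ⊖_) (members 1) ++ L.map (p12 ⊖_) (members 0)
  members (suc (suc (suc n))) =
    L.map (p1 ⊖_) (members (suc (suc n))) ++ L.map (p12 ⊖_) (members (suc n)) ++ L.map (τ ⊖_) (members n)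

  length-members : ∀ N → length (members N) ≡ t N
  length-members 0 = refl
  length-members 1 = refl
  length-members 2 = refl
  length-members (suc (suc (suc n))) = begin
    length (A ++ B ++ C)
      ≡⟨ length-++ A ⟩
    length A + length (B ++ C)
      ≡⟨ cong (length A +_) (length-++ B) ⟩
    length A + (length B + length C)
      ≡⟨ sym (+-assoc (length A) _ _) ⟩
    length A + length B + length C
      ≡⟨ cong₂ _+_ (cong₂ _+_ (length-map _ (members (suc (suc n)))) (length-map _ (members (suc n))))
                   (length-map _ (members n)) ⟩
    length (members (suc (suc n))) + length (members (suc n)) + length (members n)
      ≡⟨ cong₂ _+_ (cong₂ _+_ (length-members (suc (suc n))) (length-members (suc n))) (length-members n) ⟩
    t (3 + n)
      ∎
    where
    open ≡-Reasoning
    A = L.map (p1 ⊖_) (members (suc (suc n)))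
    B = L.map (p12 ⊖_) (members (suc n))
    C = L.map (τ ⊖_) (members n)

  τ⊖-values : ∀ {n} (ρ : Word n n) → values (τ ⊖ ρ) ≡
    toℕ (lookup τ zero) + n ∷ toℕ (lookup τ (suc zero)) + n ∷ toℕ (lookup τ (suc (suc zero))) + n ∷ values ρ
  τ⊖-values {n} ρ = trans (values-⊖ τ ρ) (cong (λ xs → shift n xs ++ values ρ) (values-triple τ))

  1⊖≢12⊖ : ∀ {n} {ρ : Word (1 + n) (1 + n)} {ρ′ : Word n n} → p1 ⊖ ρ ≢ p12 ⊖ ρ′
  1⊖≢12⊖ {n} {ρ} {ρ′} eq =
    1+n≢n (∷-injectiveˡ (trans (sym (values-⊖ p1 ρ)) (trans (cong values eq) (values-⊖ p12 ρ′))))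

  1⊖≢τ⊖ : ∀ {n} {ρ : Word (2 + n) (2 + n)} {ρ′ : Word n n} → p1 ⊖ ρ ≢ τ ⊖ ρ′
  1⊖≢τ⊖ {n} {ρ} {ρ′} eq with heads ← trans (sym (values-⊖ p1 ρ)) (trans (cong values eq) (τ⊖-values ρ′)) =
    τ₀≢2 (+-cancelʳ-≡ n _ 2 (sym (∷-injectiveˡ heads)))

  12⊖≢τ⊖ : ∀ {n} {ρ : Word (1 + n) (1 + n)} {ρ′ : Word n n} → p12 ⊖ ρ ≢ τ ⊖ ρ′
  12⊖≢τ⊖ {n} {ρ} {ρ′} eq with heads ← trans (sym (values-⊖ p12 ρ)) (trans (cong values eq) (τ⊖-values ρ′)) =
    τ₀τ₁≢12 (+-cancelʳ-≡ n _ 1 (sym (∷-injectiveˡ heads)) ,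
             +-cancelʳ-≡ n _ 2 (sym (∷-injectiveˡ (∷-injectiveʳ heads))))

  stack-unique : ∀ {j n} (α : Word j j) {ws : List (Word n n)} → Unique ws → Unique (L.map (α ⊖_) ws)
  stack-unique α = Unique.map⁺ (⊖-injectiveʳ α)

  members-unique : ∀ N → Unique (members N)
  members-unique 0 = [] ∷ []
  members-unique 1 = stack-unique p1 (members-unique 0)
  members-unique 2 = Unique.++⁺ (stack-unique p1 (members-unique 1)) (stack-unique p12 (members-unique 0))
                       (map-disjoint {f = p1 ⊖_} {g = p12 ⊖_} 1⊖≢12⊖)
  members-unique (suc (suc (suc n))) =
    Unique.++⁺ (stack-unique p1 (members-unique (suc (suc n))))
      (Unique.++⁺ (stack-unique p12 (members-unique (suc n))) (stack-unique τ (members-unique n))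
        (map-disjoint 12⊖≢τ⊖))
      λ (w∈A , w∈B++C) → Sum.[ (λ w∈B → map-disjoint 1⊖≢12⊖ (w∈A , w∈B)) ,
                               (λ w∈C → map-disjoint 1⊖≢τ⊖ (w∈A , w∈C)) ]
                           (∈-++⁻ (L.map (p12 ⊖_) (members (suc n))) w∈B++C)

  av-stack : ∀ {j n} (α : Word j j) {ws : List (Word n n)} → Av ps (shift n (values α)) →
             (∀ {ρ} → ρ ∈ ws → Av ps (values ρ)) → ∀ {w} → w ∈ L.map (α ⊖_) ws → Av ps (values w)
  av-stack {n = n} α α-av ws-av w∈ with ρ , ρ∈ , refl ← ∈-map⁻ (α ⊖_) w∈ =
    subst (Av ps) (sym (values-⊖ α ρ))
      (av-skewSum ps-firstBelowLast (shift-≥ n (values α)) (values-bounded ρ) α-av (ws-av ρ∈))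

  av-1 : ∀ n → Av ps (shift n (values p1))
  av-1 n = [] ∷ [] , avoiding-short (All.map (<-trans (n<1+n 1)) ps-long)

  av-12 : ∀ n → Av ps (shift n (values p12))
  av-12 n = (<⇒≢ (n<1+n n) ∷ []) ∷ [] ∷ [] , avoiding-short ps-long

  av-τ : ∀ n → Av ps (shift n (values τ))
  av-τ n = Unique.map⁺ (+-cancelʳ-≡ n _ _) τ! , τ-avoiding n

  members-av : ∀ N {w} → w ∈ members N → Av ps (values w)
  members-av 0 (here refl) = [] , avoiding-short (All.map (<-trans z<s) ps-long)
  members-av 1 = av-stack p1 (av-1 0) (members-av 0)
  members-av 2 = Sum.[ av-stack p1 (av-1 1) (members-av 1) , av-stack p12 (av-12 0) (members-av 0) ]
                 ∘ ∈-++⁻ (L.map (p1 ⊖_) (members 1))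
  members-av (suc (suc (suc n))) =
    Sum.[ av-stack p1 (av-1 (2 + n)) (members-av (suc (suc n))) ,
          Sum.[ av-stack p12 (av-12 (1 + n)) (members-av (suc n)) , av-stack τ (av-τ n) (members-av n) ]
          ∘ ∈-++⁻ (L.map (p12 ⊖_) (members (suc n))) ]
    ∘ ∈-++⁻ (L.map (p1 ⊖_) (members (suc (suc n))))

  data Decomposition : ∀ {N} → Word N N → Set where
    one   : ∀ {n} (ρ : Word n n) → Av ps (values ρ) → Decomposition (p1 ⊖ ρ)
    two   : ∀ {n} (ρ : Word n n) → Av ps (values ρ) → Decomposition (p12 ⊖ ρ)
    three : ∀ {n} (ρ : Word n n) → Av ps (values ρ) → Decomposition (τ ⊖ ρ)

  fromTopBlock : ∀ {N xs} (w : Word N N) → Av ps (values w) → values w ≡ xs → TopBlock τ N xs → Decomposition w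
  fromTopBlock w w-av eq (one _)   with ρ , refl , ρ-av ← peel p1 (proj₁ (av-1 0)) w w-av eq   = one ρ ρ-av
  fromTopBlock w w-av eq (two _)   with ρ , refl , ρ-av ← peel p12 (proj₁ (av-12 0)) w w-av eq = two ρ ρ-av
  fromTopBlock w w-av eq (three _) with ρ , refl , ρ-av ← peel τ τ! w w-av eq                  = three ρ ρ-av

  decompose : ∀ {N} (w : Word (suc N) (suc N)) → Av ps (values w) → Decomposition w
  decompose w w-av@(w! , _) =
    fromTopBlock w w-av refl (topBlock w-av (values-bounded w) (isPerm⇒covers w (unique⇒distinct w w!)))

  members-complete : ∀ N (w : Word N N) → Av ps (values w) → w ∈ members N
  members-complete zero [] _ = here refl
  members-complete (suc N) w w-av with decompose w w-av
  members-complete 1 _ _ | one ρ ρ-av = ∈-map⁺ (p1 ⊖_) (members-complete 0 ρ ρ-av)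
  members-complete 2 _ _ | one ρ ρ-av = ∈-++⁺ˡ (∈-map⁺ (p1 ⊖_) (members-complete 1 ρ ρ-av))
  members-complete 2 _ _ | two ρ ρ-av =
    ∈-++⁺ʳ (L.map (p1 ⊖_) (members 1)) (∈-map⁺ (p12 ⊖_) (members-complete 0 ρ ρ-av))
  members-complete (suc (suc (suc n))) _ _ | one ρ ρ-av =
    ∈-++⁺ˡ (∈-map⁺ (p1 ⊖_) (members-complete (suc (suc n)) ρ ρ-av))
  members-complete (suc (suc (suc n))) _ _ | two ρ ρ-av =
    ∈-++⁺ʳ (L.map (p1 ⊖_) (members (suc (suc n)))) (∈-++⁺ˡ (∈-map⁺ (p12 ⊖_) (members-complete (suc n) ρ ρ-av)))
  members-complete (suc (suc (suc n))) _ _ | three ρ ρ-av =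
    ∈-++⁺ʳ (L.map (p1 ⊖_) (members (suc (suc n))))
      (∈-++⁺ʳ (L.map (p12 ⊖_) (members (suc n))) (∈-map⁺ (τ ⊖_) (members-complete n ρ ρ-av)))

  hasCard : ∀ N → HasCard N ps (t N)
  hasCard N = members N , members-unique N ,
    (λ w → mk⇔ (Equivalence.from (inS⇔av ps-involutive w) ∘ members-av N)
               (members-complete N w ∘ Equivalence.to (inS⇔av ps-involutive w))) ,
    length-members N

involutive? : (p : Pattern) → Dec (Involutive p)
involutive? (pat k σ) = FP.all? λ a → lookup σ (lookup σ a) FP.≟ a

firstBelowLast-123 : FirstBelowLast (Shaped (pat 3 p123))
firstBelowLast-123 (_ ∷ _ ∷ _ ∷ [] , a<b ∷ b<c ∷ [-] , refl) = <-trans a<b b<c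

firstBelowLast-132 : FirstBelowLast (Shaped (pat 3 p132))
firstBelowLast-132 (_ ∷ _ ∷ _ ∷ [] , a<b ∷ _ , refl) = a<b

firstBelowLast-213 : FirstBelowLast (Shaped (pat 3 p213))
firstBelowLast-213 (_ ∷ _ ∷ _ ∷ [] , _ ∷ b<c ∷ [-] , refl) = b<c

firstBelowLast-3214 : FirstBelowLast (Shaped (pat 4 p3214))
firstBelowLast-3214 (_ ∷ _ ∷ _ ∷ _ ∷ [] , _ ∷ _ ∷ c<d ∷ [-] , refl) = c<d

firstBelowLast-1432 : FirstBelowLast (Shaped (pat 4 p1432))
firstBelowLast-1432 (_ ∷ _ ∷ _ ∷ _ ∷ [] , a<b ∷ _ , refl) = a<b

firstBelowLast-1234 : FirstBelowLast (Shaped (pat 4 p1234))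
firstBelowLast-1234 (_ ∷ _ ∷ _ ∷ _ ∷ [] , a<b ∷ b<c ∷ c<d ∷ [-] , refl) = <-trans (<-trans a<b b<c) c<d

-- Av(123, 132, 3214)

ps₁ : List Pattern
ps₁ = pat 3 p123 ∷ pat 3 p132 ∷ pat 4 p3214 ∷ []

two-larger-after₁ : ∀ {x b c xs} → Avoiding ps₁ (x ∷ xs) → b ∈ xs → c ∈ xs → b ≢ c → x < b → x < c → ⊥
two-larger-after₁ {b = b} {c} (¬123 ∷ ¬132 ∷ _) b∈ c∈ b≢c x<b x<c with in-some-order b∈ c∈ b≢c | <-cmp b c
... | _       | tri≈ _ b≡c _ = b≢c b≡c
... | inj₁ bc | tri< b<c _ _ = ¬123 (_ , refl ∷ bc , (_ , x<b ∷ b<c ∷ [-] , refl))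
... | inj₁ bc | tri> _ _ c<b = ¬132 (_ , refl ∷ bc , (_ , x<c ∷ c<b ∷ [-] , refl))
... | inj₂ cb | tri< b<c _ _ = ¬132 (_ , refl ∷ cb , (_ , x<b ∷ b<c ∷ [-] , refl))
... | inj₂ cb | tri> _ _ c<b = ¬123 (_ , refl ∷ cb , (_ , x<c ∷ c<b ∷ [-] , refl))

-- With m the largest value, the first entry is m or m - 1 by two-larger-after₁, the entry after m - 1 is
-- m or m - 2 likewise, and the entry after m - 1, m - 2 is m, as a smaller one followed by m is a 3214.
topBlock₁-third : ∀ {y r} → Av ps₁ (suc y ∷ y ∷ r) → All (_< 3 + y) r → Covers (3 + y) (suc y ∷ y ∷ r) →
                  TopBlock p213 (3 + y) (suc y ∷ y ∷ r)
topBlock₁-third {y} {[]} _ _ cov with () ← later (_ ∷ _ ∷ []) cov (n<1+n _) (n<1+n _ ∷ n<2+n y ∷ [])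
topBlock₁-third {y} {z ∷ r} ((_ ∷ 1+y≢z ∷ _) ∷ (y≢z ∷ _) ∷ _ , _ ∷ _ ∷ ¬3214 ∷ []) (z<3+y ∷ _) cov
  with m<1+n⇒m<n∨m≡n z<3+y
... | inj₂ refl  = three r
... | inj₁ z<2+y =
  ⊥-elim (¬3214 (_ , refl ∷ refl ∷ refl ∷ from∈ 2+y∈r , (_ , z<y ∷ n<1+n y ∷ n<1+n (suc y) ∷ [-] , refl)))
  where
  z<y   = <-pred≢ (<-pred≢ z<2+y (1+y≢z ∘ sym)) (y≢z ∘ sym)
  2+y∈r = later (_ ∷ _ ∷ _ ∷ []) cov (n<1+n _) (n<1+n _ ∷ n<2+n y ∷ z<2+y ∷ [])

topBlock₁-second : ∀ {x r} → Av ps₁ (x ∷ r) → All (_< 2 + x) r → Covers (2 + x) (x ∷ r) →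
                   TopBlock p213 (2 + x) (x ∷ r)
topBlock₁-second {x} {[]} _ _ cov with () ← later (_ ∷ []) cov (n<1+n _) (n<1+n x ∷ [])
topBlock₁-second {x} {y ∷ r} x∷y∷r-av@((x≢y ∷ _) ∷ _ , av) (y<2+x ∷ r<) cov with m<1+n⇒m<n∨m≡n y<2+x
... | inj₂ refl  = two r
... | inj₁ y<1+x with <-pred≢ y<1+x (x≢y ∘ sym)
...   | s≤s y≤X with m≤n⇒m<n∨m≡n y≤X
...     | inj₂ refl = topBlock₁-third x∷y∷r-av r< cov
...     | inj₁ y<X  =
  ⊥-elim (two-larger-after₁ (avoiding-⊆ (_ ∷ʳ ⊆-refl) av) X∈r 2+X∈r (<⇒≢ (n<2+n _)) y<X y<2+X)
  where
  y<2+X = <-trans y<X (n<2+n _)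
  X∈r   = ∈-skip (_ ∷ _ ∷ []) (cov (m<n⇒m<1+n (n<2+n _))) (<⇒≢ (n<1+n _) ∷ >⇒≢ y<X ∷ [])
  2+X∈r = later (_ ∷ _ ∷ []) cov (n<1+n _) (n<1+n _ ∷ y<2+X ∷ [])

topBlock₁ : ∀ {N xs} → Av ps₁ xs → All (_< suc N) xs → Covers (suc N) xs → TopBlock p213 (suc N) xs
topBlock₁ {xs = []}    _ _ cov with () ← cov z<s
topBlock₁ {xs = x ∷ r} x∷r-av@(_ , av) (x<1+N ∷ r<) cov with m<1+n⇒m<n∨m≡n x<1+N
... | inj₂ refl = one r
... | inj₁ (s≤s x≤M) with m≤n⇒m<n∨m≡n x≤M
...   | inj₂ refl = topBlock₁-second x∷r-av r< cov
...   | inj₁ x<M  = ⊥-elim (two-larger-after₁ av M∈r 1+M∈r (<⇒≢ (n<1+n _)) x<M x<1+M)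
  where
  x<1+M = m<n⇒m<1+n x<M
  M∈r   = later (_ ∷ []) cov (n<2+n _) (x<M ∷ [])
  1+M∈r = later (_ ∷ []) cov (n<1+n _) (x<1+M ∷ [])

τ-avoiding₁ : ∀ n → Avoiding ps₁ (shift n (values p213))
τ-avoiding₁ n =
  ¬shaped⇒¬occurs (pat 3 p123) ≤-refl (λ { (_ ∷ _ ∷ _ ∷ [] , a<b ∷ _ , refl) → <-asym a<b (n<1+n n) }) ∷
  ¬shaped⇒¬occurs (pat 3 p132) ≤-refl
    (λ { (_ ∷ _ ∷ _ ∷ [] , a<b ∷ b<c ∷ [-] , refl) → <-asym (<-trans a<b b<c) (n<1+n n) }) ∷
  ¬occurs-longer (pat 4 p3214) ≤-refl ∷ []

module Class₁ = TribonacciClass ps₁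
  (from-yes (All.all? involutive? ps₁)) (from-yes (All.all? (λ p → 2 <? size p) ps₁))
  (firstBelowLast-123 ∷ firstBelowLast-132 ∷ firstBelowLast-3214 ∷ [])
  p213 (from-yes (unique? (values p213))) τ-avoiding₁ (λ ()) (λ ()) topBlock₁

-- Av(123, 213, 1432)

ps₂ : List Pattern
ps₂ = pat 3 p123 ∷ pat 3 p213 ∷ pat 4 p1432 ∷ []

nothing-above₂ : ∀ {x y T r} → Avoiding ps₂ (x ∷ y ∷ r) → T ∈ r → x < T → y < T → y ≢ x → ⊥
nothing-above₂ {x} {y} (¬123 ∷ ¬213 ∷ _) T∈ x<T y<T y≢x with <-cmp x y
... | tri≈ _ x≡y _ = y≢x (sym x≡y)
... | tri< x<y _ _ = ¬123 (_ , refl ∷ refl ∷ from∈ T∈ , (_ , x<y ∷ y<T ∷ [-] , refl))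
... | tri> _ _ y<x = ¬213 (_ , refl ∷ refl ∷ from∈ T∈ , (_ , y<x ∷ x<T ∷ [-] , refl))

nothing-between₂ : ∀ {x T b c r} → Avoiding ps₂ (x ∷ T ∷ r) → b ∈ r → c ∈ r → x < b → b < c → c < T → ⊥
nothing-between₂ (¬123 ∷ _ ∷ ¬1432 ∷ []) b∈ c∈ x<b b<c c<T with in-some-order b∈ c∈ (<⇒≢ b<c)
... | inj₁ bc = ¬123 (_ , refl ∷ _ ∷ʳ bc , (_ , x<b ∷ b<c ∷ [-] , refl))
... | inj₂ cb = ¬1432 (_ , refl ∷ refl ∷ cb , (_ , x<b ∷ b<c ∷ c<T ∷ [-] , refl))

-- With m the largest value, a first entry x < m is followed by m (nothing-above₂), x is m - 1 or m - 2
-- (nothing-between₂), and after m - 2, m comes m - 1, as a smaller entry followed by m - 1 is a 213.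
topBlock₂-third : ∀ {x r} → Av ps₂ (x ∷ 2 + x ∷ r) → All (_< 3 + x) r → Covers (3 + x) (x ∷ 2 + x ∷ r) →
                  TopBlock p132 (3 + x) (x ∷ 2 + x ∷ r)
topBlock₂-third {x} {[]} _ _ cov
  with () ← ∈-skip (_ ∷ _ ∷ []) (cov (n<2+n (suc x))) (>⇒≢ (n<1+n x) ∷ <⇒≢ (n<1+n _) ∷ [])
topBlock₂-third {x} {z ∷ r} ((_ ∷ x≢z ∷ _) ∷ (2+x≢z ∷ _) ∷ _ , _ ∷ ¬213 ∷ _) (z<3+x ∷ _) cov with z ℕ.≟ suc x
... | yes refl  = three r
... | no  z≢1+x = ⊥-elim (¬213 (_ , refl ∷ _ ∷ʳ refl ∷ from∈ 1+x∈r , (_ , z<x ∷ n<1+n x ∷ [-] , refl)))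
  where
  z<x   = <-pred≢ (<-pred≢ (<-pred≢ z<3+x (2+x≢z ∘ sym)) z≢1+x) (x≢z ∘ sym)
  1+x∈r = ∈-skip (_ ∷ _ ∷ _ ∷ []) (cov (n<2+n (suc x)))
            (>⇒≢ (n<1+n x) ∷ <⇒≢ (n<1+n _) ∷ >⇒≢ (m<n⇒m<1+n z<x) ∷ [])

topBlock₂-second : ∀ {N x r} → Av ps₂ (x ∷ r) → All (_< suc N) r → Covers (suc N) (x ∷ r) → x < N →
                   TopBlock p132 (suc N) (x ∷ r)
topBlock₂-second {r = []} _ _ cov x<N with () ← later (_ ∷ []) cov (n<1+n _) (x<N ∷ [])
topBlock₂-second {N} {x} {y ∷ r} x∷y∷r-av@((x≢y ∷ _) ∷ _ , av) (y<1+N ∷ r<) cov x<N with m<1+n⇒m<n∨m≡n y<1+N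
... | inj₁ y<N =
  ⊥-elim (nothing-above₂ av (later (_ ∷ _ ∷ []) cov (n<1+n N) (x<N ∷ y<N ∷ [])) x<N y<N (x≢y ∘ sym))
... | inj₂ refl with x<N
...   | s≤s x≤M with m≤n⇒m<n∨m≡n x≤M
...     | inj₂ refl = two r
...     | inj₁ (s≤s x≤k) with m≤n⇒m<n∨m≡n x≤k
...       | inj₂ refl = topBlock₂-third x∷y∷r-av r< cov
...       | inj₁ x<k  = ⊥-elim (nothing-between₂ av k∈r 1+k∈r x<k (n<1+n _) (n<1+n _))
  where
  k∈r   = ∈-skip (_ ∷ _ ∷ []) (cov (m<n⇒m<1+n (n<2+n _))) (>⇒≢ x<k ∷ <⇒≢ (n<2+n _) ∷ [])
  1+k∈r = ∈-skip (_ ∷ _ ∷ []) (cov (n<2+n _)) (>⇒≢ (m<n⇒m<1+n x<k) ∷ <⇒≢ (n<1+n _) ∷ [])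

topBlock₂ : ∀ {N xs} → Av ps₂ xs → All (_< suc N) xs → Covers (suc N) xs → TopBlock p132 (suc N) xs
topBlock₂ {xs = []}    _ _ cov with () ← cov z<s
topBlock₂ {xs = x ∷ r} x∷r-av (x<1+N ∷ r<) cov with m<1+n⇒m<n∨m≡n x<1+N
... | inj₂ refl = one r
... | inj₁ x<N  = topBlock₂-second x∷r-av r< cov x<N

τ-avoiding₂ : ∀ n → Avoiding ps₂ (shift n (values p132))
τ-avoiding₂ n =
  ¬shaped⇒¬occurs (pat 3 p123) ≤-refl (λ { (_ ∷ _ ∷ _ ∷ [] , _ ∷ b<c ∷ [-] , refl) → <-asym b<c (n<1+n _) }) ∷
  ¬shaped⇒¬occurs (pat 3 p213) ≤-refl (λ { (_ ∷ _ ∷ _ ∷ [] , a<b ∷ _ , refl) → <-asym a<b (n<2+n n) }) ∷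
  ¬occurs-longer (pat 4 p1432) ≤-refl ∷ []

module Class₂ = TribonacciClass ps₂
  (from-yes (All.all? involutive? ps₂)) (from-yes (All.all? (λ p → 2 <? size p) ps₂))
  (firstBelowLast-123 ∷ firstBelowLast-213 ∷ firstBelowLast-1432 ∷ [])
  p132 (from-yes (unique? (values p132))) τ-avoiding₂ (λ ()) (λ ()) topBlock₂

-- Av(132, 213, 1234)

ps₃ : List Pattern
ps₃ = pat 3 p132 ∷ pat 3 p213 ∷ pat 4 p1234 ∷ []

successor-next₃ : ∀ {x y T r} → Avoiding ps₃ (x ∷ y ∷ r) → x < T → T ∈ y ∷ r → suc x ∈ y ∷ r → y ≢ x → y ≡ suc x
successor-next₃ {x} {y} (¬132 ∷ ¬213 ∷ _) x<T T∈ 1+x∈ y≢x with <-cmp y x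
... | tri≈ _ y≡x _ = ⊥-elim (y≢x y≡x)
... | tri< y<x _ _ =
  ⊥-elim (¬213 (_ , refl ∷ refl ∷ from∈ (∈-skip (_ ∷ []) T∈ (>⇒≢ (<-trans y<x x<T) ∷ [])) ,
                (_ , y<x ∷ x<T ∷ [-] , refl)))
... | tri> _ _ x<y with y ℕ.≟ suc x
...   | yes y≡1+x = y≡1+x
...   | no  y≢1+x = ⊥-elim (¬132 (_ , refl ∷ refl ∷ from∈ (∈-skip (_ ∷ []) 1+x∈ ((y≢1+x ∘ sym) ∷ [])) ,
                                   (_ , n<1+n x ∷ ≤∧≢⇒< x<y (y≢1+x ∘ sym) ∷ [-] , refl)))

-- By successor-next₃ a member starts with a run x, x + 1, … ending in the largest value m; a run x, x + 1,
-- x + 2 of entries below m would form a 1234 with m.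
topBlock₃-third : ∀ {N x r} → Av ps₃ (x ∷ suc x ∷ r) → All (_< suc N) r → Covers (suc N) (x ∷ suc x ∷ r) →
                  suc x < N → TopBlock p123 (suc N) (x ∷ suc x ∷ r)
topBlock₃-third {r = []} _ _ cov 1+x<N
  with () ← later (_ ∷ _ ∷ []) cov (n<1+n _) (<-trans (n<1+n _) 1+x<N ∷ 1+x<N ∷ [])
topBlock₃-third {N} {x} {z ∷ r} (_ ∷ (1+x≢z ∷ _) ∷ _ , av@(_ ∷ _ ∷ ¬1234 ∷ [])) (_ ∷ r<) cov 1+x<N
  with refl ← successor-next₃ (avoiding-⊆ (_ ∷ʳ ⊆-refl) av) 1+x<N
                (later (_ ∷ _ ∷ []) cov (n<1+n N) (<-trans (n<1+n x) 1+x<N ∷ 1+x<N ∷ []))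
                (later (_ ∷ _ ∷ []) cov (s≤s 1+x<N) (n<2+n x ∷ n<1+n _ ∷ []))
                (1+x≢z ∘ sym)
     | m≤n⇒m<n∨m≡n 1+x<N
... | inj₂ refl  = three r
... | inj₁ 2+x<N =
  ⊥-elim (¬1234 (_ , refl ∷ refl ∷ refl ∷ from∈ N∈r , (_ , n<1+n _ ∷ n<1+n _ ∷ 2+x<N ∷ [-] , refl)))
  where
  N∈r = later (_ ∷ _ ∷ _ ∷ []) cov (n<1+n N) (<-trans (n<2+n x) 2+x<N ∷ <-trans (n<1+n _) 2+x<N ∷ 2+x<N ∷ [])

topBlock₃-second : ∀ {N x r} → Av ps₃ (x ∷ r) → All (_< suc N) r → Covers (suc N) (x ∷ r) → x < N →
                   TopBlock p123 (suc N) (x ∷ r)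
topBlock₃-second {r = []} _ _ cov x<N with () ← later (_ ∷ []) cov (n<1+n _) (x<N ∷ [])
topBlock₃-second {N} {x} {y ∷ r} x∷y∷r-av@((x≢y ∷ _) ∷ _ , av) (_ ∷ r<) cov x<N
  with refl ← successor-next₃ av x<N (later (_ ∷ []) cov (n<1+n N) (x<N ∷ []))
                (later (_ ∷ []) cov (s≤s x<N) (n<1+n x ∷ [])) (x≢y ∘ sym)
     | m≤n⇒m<n∨m≡n x<N
... | inj₂ refl  = two r
... | inj₁ 1+x<N = topBlock₃-third x∷y∷r-av r< cov 1+x<N

topBlock₃ : ∀ {N xs} → Av ps₃ xs → All (_< suc N) xs → Covers (suc N) xs → TopBlock p123 (suc N) xs
topBlock₃ {xs = []}    _ _ cov with () ← cov z<s
topBlock₃ {xs = x ∷ r} x∷r-av (x<1+N ∷ r<) cov with m<1+n⇒m<n∨m≡n x<1+N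
... | inj₂ refl = one r
... | inj₁ x<N  = topBlock₃-second x∷r-av r< cov x<N

τ-avoiding₃ : ∀ n → Avoiding ps₃ (shift n (values p123))
τ-avoiding₃ n =
  ¬shaped⇒¬occurs (pat 3 p132) ≤-refl (λ { (_ ∷ _ ∷ _ ∷ [] , _ ∷ b<c ∷ [-] , refl) → <-asym b<c (n<1+n _) }) ∷
  ¬shaped⇒¬occurs (pat 3 p213) ≤-refl (λ { (_ ∷ _ ∷ _ ∷ [] , a<b ∷ _ , refl) → <-asym a<b (n<1+n n) }) ∷
  ¬occurs-longer (pat 4 p1234) ≤-refl ∷ []

module Class₃ = TribonacciClass ps₃
  (from-yes (All.all? involutive? ps₃)) (from-yes (All.all? (λ p → 2 <? size p) ps₃))
  (firstBelowLast-132 ∷ firstBelowLast-213 ∷ firstBelowLast-1234 ∷ [])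
  p123 (from-yes (unique? (values p123))) τ-avoiding₃ (λ ()) (λ ()) topBlock₃

theorem3p3 : (n : ℕ) →
    HasCard (suc n) (pat 3 p123 ∷ pat 3 p132 ∷ pat 4 p3214 ∷ []) (t (suc n)) ×
    HasCard (suc n) (pat 3 p123 ∷ pat 3 p213 ∷ pat 4 p1432 ∷ []) (t (suc n)) ×
    HasCard (suc n) (pat 3 p132 ∷ pat 3 p213 ∷ pat 4 p1234 ∷ []) (t (suc n))
theorem3p3 n = Class₁.hasCard (suc n) , Class₂.hasCard (suc n) , Class₃.hasCard (suc n)
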